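{- Let $p$ be a prime, let $G$ be a finite abelian $p$-group, and let $S=(g_1,\dots,g_\ell)$ be a zero-sumfree sequence in $G$ with $|S| \geq \mathsf{d}(G)-p+2$. Then every term $g_i$ of $S$ has height $\alpha(g_i)=1$.
   Context: A sequence in $G$ is a finite unordered list of elements with repetition allowed; $|S|$ is its length counted with multiplicity. A sequence is zero-sumfree if no nonempty subsequence has sum $0$. $\mathsf{d}(G)$ is the maximal length of a zero-sumfree sequence in $G$. For $g \in G$, the height of $g$ is $\alpha(g)=\max\{p^n : n \geq 0,\ \exists h \in G \text{ with } g=p^n h\}$. -}

module Defs where

open import Level using (Level)
open import Algebra.Bundles using (AbelianGroup)
open import Data.Nat using (ℕ; zero; suc; _^_; _≤_)
open import Data.List using (List; []; _∷_; foldr; length)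
open import Data.List.Relation.Unary.Any using (Any)
open import Data.List.Membership.Propositional using (_∈_)
open import Data.List.Relation.Binary.Sublist.Propositional using (_⊆_)
open import Data.Product using (Σ; ∃; _×_)
open import Relation.Binary.PropositionalEquality using (_≡_)
open import Relation.Nullary using (¬_)

module _ {c ℓ : Level} (G : AbelianGroup c ℓ) where
  open AbelianGroup G

  mulℕ : ℕ → Carrier → Carrier
  mulℕ zero    g = ε
  mulℕ (suc n) g = g ∙ mulℕ n g

  σ : List Carrier → Carrier
  σ = foldr _∙_ ε

  IsFinite : Set (c Level.⊔ ℓ)
  IsFinite = Σ (List Carrier) λ xs → ∀ x → Any (x ≈_) xs

  IsPTorsion : ℕ → Set (c Level.⊔ ℓ)
  IsPTorsion p = ∀ g → ∃ λ n → mulℕ (p ^ n) g ≈ ε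

  IsFinitePGroup : ℕ → Set (c Level.⊔ ℓ)
  IsFinitePGroup p = IsFinite × IsPTorsion p

  -- sequences are lists (order irrelevant); subsequences are sublists
  ZeroSumFree : List Carrier → Set (c Level.⊔ ℓ)
  ZeroSumFree S = ∀ T → T ⊆ S → ¬ (T ≡ []) → ¬ (σ T ≈ ε)

  IsDavenport : ℕ → Set (c Level.⊔ ℓ)
  IsDavenport D = (Σ (List Carrier) λ S → ZeroSumFree S × length S ≡ D)
                × (∀ S → ZeroSumFree S → length S ≤ D)

  HasHeight : ℕ → Carrier → ℕ → Set (c Level.⊔ ℓ)
  HasHeight p g m = (Σ ℕ λ n → (m ≡ p ^ n) × ∃ λ h → g ≈ mulℕ (p ^ n) h)
                  × (∀ n → (∃ λ h → g ≈ mulℕ (p ^ n) h) → p ^ n ≤ m)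

-- Suppose a term g of S is p·h. Replacing g by p copies of h gives a sequence T with
-- |T| = |S| + p - 1 > d(G). Let Δ_t act on functions G → ℤ as multiplication by 1 - Xᵗ
-- in ℤ[G]. For the indicator δ of 0, (Δ_S δ)(0) is the signed count of the zero-sum
-- subsequences of S, hence 1. Since p divides C(p,j) for 0 < j < p, Δ_hᵖ ≡ Δ_{p·h}
-- (mod p), so (Δ_T δ)(0) ≡ 1 (mod p). On the other hand, for a basis (e_i) of G with
-- orders p^(l_i), Olson's argument gives Δ_T ≡ 0 (mod p) as soon as
-- |T| > D*(G) = Σ (p^(l_i) - 1), because Δ_{e_i}^(p^(l_i)) ≡ Δ_{p^(l_i)·e_i} = 0; and
-- D*(G) ≤ d(G) is witnessed by the zero-sumfree sequence Π e_i^(p^(l_i) - 1).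
-- The basis comes from the usual induction that splits off an element of maximal order.
-- It needs decidable equality, which a finite group has up to double negation; that
-- suffices because the claim about heights is a negation.

module Submission where

open import Defs
open import Algebra.Bundles using (AbelianGroup)

open import Level using (Level; _⊔_)
open import Data.Nat using (ℕ; zero; suc; _^_; _∸_; _<_; _≤_; _≤?_; z≤n; s≤s; NonZero; NonTrivial; nonTrivial⇒≢1; >-nonZero⁻¹)
import Data.Nat as ℕ using (_+_; _*_; _⊔_)
import Data.Nat.Properties as ℕₚ
import Data.Nat.Divisibility as ℕ∣
open import Data.Nat.DivMod using (_%_; _/_; m≡m%n+[m/n]*n; m%n<n)
open import Data.Nat.Coprimality using (Coprime; coprime-divisor)
open import Data.Nat.Combinatorics using (_C_; nCn≡1; nC1≡n; nCk+nC[k+1]≡[n+1]C[k+1])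
open import Data.Nat.Primality using (Prime; ¬prime[0]; prime⇒nonZero; euclidsLemma; prime⇒irreducible; prime⇒nonTrivial)
import Data.Integer as ℤ
open ℤ using (ℤ; +_; -_; 0ℤ; 1ℤ; -1ℤ) renaming (_^_ to _^ℤ_)
import Data.Integer.Properties as ℤₚ
open import Data.Integer.Tactic.RingSolver using (solve-∀)
import Data.Nat.Tactic.RingSolver as ℕ-Solver
open import Data.Integer.Divisibility.Signed as ℤ∣ using (divides)
open import Data.Product using (Σ; ∃; _×_; _,_; proj₁; proj₂)
open import Data.Sum using (_⊎_; inj₁; inj₂; [_,_]′)
open import Data.Empty using (⊥-elim)
open import Relation.Nullary using (¬_; Dec; yes; no)
open import Relation.Nullary.Decidable using (¬¬-excluded-middle; map′)
open import Relation.Binary.Bundles using (Setoid)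
open import Relation.Binary.Definitions using (Decidable)
open import Data.List using (List; []; _∷_; _++_; replicate; length; foldr)
import Data.List.Properties as Listₚ
open import Data.List.Relation.Unary.All as All using (All; []; _∷_)
open import Data.List.Relation.Binary.Pointwise using (Pointwise; []; _∷_)
open import Data.List.Relation.Binary.Sublist.Propositional using (_⊆_)
open import Data.List.Membership.Propositional using (_∈_; find)
open import Data.List.Membership.Propositional.Properties using (∈-∃++; ∈-++⁻; ∈-++⁺ˡ; ∈-++⁺ʳ)
open import Data.List.Relation.Unary.Any using (Any; here; there)
open import Data.List.Extrema.Nat using (argmax; argmax-sel; f[⊥]≤f[argmax]; f[xs]≤f[argmax])
open import Data.List.Relation.Binary.Sublist.Heterogeneous using ([]; _∷_; _∷ʳ_)
open import Function.Definitions using (Congruent)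
import Relation.Binary.PropositionalEquality as ≡
open ≡ using (_≡_; _≗_)

-- Congruences modulo n

infix 4 _≡_mod_
record _≡_mod_ (x y : ℤ) (n : ℕ) : Set where
  constructor divides-difference
  field ∣-difference : + n ℤ∣.∣ x ℤ.- y

module _ {n : ℕ} where
  open import Data.Integer using (_+_; _-_; _*_)

  private
    ≡-mod-by : ∀ {a x y} → a ≡ x - y → + n ℤ∣.∣ a → x ≡ y mod n
    ≡-mod-by a≡x-y n∣a = divides-difference (≡.subst (+ n ℤ∣.∣_) a≡x-y n∣a)

  ≡-mod-reflexive : ∀ {x y} → x ≡ y → x ≡ y mod n
  ≡-mod-reflexive {x} ≡.refl = divides-difference (divides 0ℤ (ℤₚ.+-inverseʳ x))

  ≡-mod-refl : ∀ {x} → x ≡ x mod n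
  ≡-mod-refl = ≡-mod-reflexive ≡.refl

  ≡-mod-sym : ∀ {x y} → x ≡ y mod n → y ≡ x mod n
  ≡-mod-sym {x} {y} (divides-difference n∣x-y) = ≡-mod-by (eq x y) (ℤ∣.∣m⇒∣-m n∣x-y)
    where
    eq : ∀ x y → - (x - y) ≡ y - x
    eq = solve-∀

  ≡-mod-trans : ∀ {x y z} → x ≡ y mod n → y ≡ z mod n → x ≡ z mod n
  ≡-mod-trans {x} {y} {z} (divides-difference n∣x-y) (divides-difference n∣y-z) =
    ≡-mod-by (eq x y z) (ℤ∣.∣m∣n⇒∣m+n n∣x-y n∣y-z)
    where
    eq : ∀ x y z → (x - y) + (y - z) ≡ x - z
    eq = solve-∀

  ≡-mod-+ : ∀ {a b c d} → a ≡ b mod n → c ≡ d mod n → a + c ≡ b + d mod n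
  ≡-mod-+ {a} {b} {c} {d} (divides-difference n∣a-b) (divides-difference n∣c-d) =
    ≡-mod-by (eq a b c d) (ℤ∣.∣m∣n⇒∣m+n n∣a-b n∣c-d)
    where
    eq : ∀ a b c d → (a - b) + (c - d) ≡ (a + c) - (b + d)
    eq = solve-∀

  ≡-mod-- : ∀ {a b c d} → a ≡ b mod n → c ≡ d mod n → a - c ≡ b - d mod n
  ≡-mod-- {a} {b} {c} {d} (divides-difference n∣a-b) (divides-difference n∣c-d) =
    ≡-mod-by (eq a b c d) (ℤ∣.∣m∣n⇒∣m-n n∣a-b n∣c-d)
    where
    eq : ∀ a b c d → (a - b) - (c - d) ≡ (a - c) - (b - d)
    eq = solve-∀

  ≡-mod-*ʳ : ∀ c {a b} → a ≡ b mod n → a * c ≡ b * c mod n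
  ≡-mod-*ʳ c {a} {b} (divides-difference n∣a-b) = ≡-mod-by (eq c a b) (ℤ∣.∣m⇒∣m*n c n∣a-b)
    where
    eq : ∀ c a b → (a - b) * c ≡ a * c - b * c
    eq = solve-∀

  ∣⇒≡0-mod : ∀ {x} → + n ℤ∣.∣ x → x ≡ 0ℤ mod n
  ∣⇒≡0-mod {x} = ≡-mod-by (≡.sym (ℤₚ.+-identityʳ x))

  1≢0-mod : .{{NonTrivial n}} → ¬ (1ℤ ≡ 0ℤ mod n)
  1≢0-mod (divides-difference n∣1) = nonTrivial⇒≢1 (ℕ∣.∣1⇒≡1 (ℤ∣.∣⇒∣ᵤ n∣1))

≡-mod-setoid : ℕ → Setoid Level.zero Level.zero
≡-mod-setoid n = record
  { Carrier = ℤ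
  ; _≈_ = λ x y → x ≡ y mod n
  ; isEquivalence = record { refl = ≡-mod-refl ; sym = ≡-mod-sym ; trans = ≡-mod-trans }
  }

-- Binomial coefficients and the coefficients of (1 - X)ᵏ

[1+k]*[1+n]C[1+k]≡[1+n]*nCk : ∀ n k → suc k ℕ.* (suc n C suc k) ≡ suc n ℕ.* (n C k)
[1+k]*[1+n]C[1+k]≡[1+n]*nCk zero    zero    = ≡.refl
[1+k]*[1+n]C[1+k]≡[1+n]*nCk zero    (suc k) = ℕₚ.*-zeroʳ (suc (suc k))
[1+k]*[1+n]C[1+k]≡[1+n]*nCk (suc n) zero    =
  ≡.trans (ℕₚ.*-identityˡ _) (≡.trans (nC1≡n (suc (suc n))) (≡.sym (ℕₚ.*-identityʳ _)))
[1+k]*[1+n]C[1+k]≡[1+n]*nCk (suc n) (suc k) = begin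
  suc (suc k) ℕ.* (suc (suc n) C suc (suc k))   ≡⟨ ≡.cong (suc (suc k) ℕ.*_) (≡.sym (pascal (suc n) (suc k))) ⟩
  suc (suc k) ℕ.* (A ℕ.+ suc n C suc (suc k))     ≡⟨ ℕₚ.*-distribˡ-+ (suc (suc k)) A _ ⟩
  A ℕ.+ suc k ℕ.* A ℕ.+ suc (suc k) ℕ.* (suc n C suc (suc k))
    ≡⟨ ≡.cong₂ (λ x y → A ℕ.+ x ℕ.+ y) ([1+k]*[1+n]C[1+k]≡[1+n]*nCk n k) ([1+k]*[1+n]C[1+k]≡[1+n]*nCk n (suc k)) ⟩
  A ℕ.+ suc n ℕ.* (n C k) ℕ.+ suc n ℕ.* (n C suc k)   ≡⟨ ℕₚ.+-assoc A _ _ ⟩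
  A ℕ.+ (suc n ℕ.* (n C k) ℕ.+ suc n ℕ.* (n C suc k)) ≡⟨ ≡.cong (A ℕ.+_) (≡.sym (ℕₚ.*-distribˡ-+ (suc n) (n C k) _)) ⟩
  A ℕ.+ suc n ℕ.* (n C k ℕ.+ n C suc k)             ≡⟨ ≡.cong (λ x → A ℕ.+ suc n ℕ.* x) (pascal n k) ⟩
  suc (suc n) ℕ.* A                             ∎
  where
  open ≡.≡-Reasoning
  A = suc n C suc k
  pascal = nCk+nC[k+1]≡[n+1]C[k+1]

p∣pCk : ∀ {p} → Prime p → ∀ {k} → 0 < k → k < p → p ℕ∣.∣ p C k
p∣pCk {suc n} p-prime {suc k} _ k<p
  with euclidsLemma (suc k) (suc n C suc k) p-prime
         (ℕ∣.divides (n C k) (≡.trans ([1+k]*[1+n]C[1+k]≡[1+n]*nCk n k) (ℕₚ.*-comm (suc n) (n C k))))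
... | inj₁ p∣1+k = ⊥-elim (ℕₚ.<⇒≱ k<p (ℕ∣.∣⇒≤ p∣1+k))
... | inj₂ p∣pCk = p∣pCk

module _ where
  open import Data.Integer using (_+_; _-_; _*_)

  -1^n-parity : ∀ n → (-1ℤ ^ℤ n ≡ 1ℤ × 2 ℕ∣.∣ n) ⊎ (-1ℤ ^ℤ n ≡ -1ℤ × 2 ℕ∣.∣ suc n)
  -1^n-parity zero = inj₁ (≡.refl , ℕ∣.divides 0 ≡.refl)
  -1^n-parity (suc n) with -1^n-parity n
  ... | inj₁ (eq , 2∣n)   = inj₂ (≡.cong (-1ℤ *_) eq , ℕ∣.∣m∣n⇒∣m+n ℕ∣.∣-refl 2∣n)
  ... | inj₂ (eq , 2∣1+n) = inj₁ (≡.cong (-1ℤ *_) eq , 2∣1+n)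

  -1^p≡-1-mod-p : ∀ {p} → Prime p → -1ℤ ^ℤ p ≡ -1ℤ mod p
  -1^p≡-1-mod-p {p} p-prime with -1^n-parity p
  ... | inj₂ (eq , _) = ≡-mod-reflexive eq
  ... | inj₁ (_ , 2∣p) with prime⇒irreducible p-prime 2∣p
  ...   | inj₂ ≡.refl = divides-difference (divides 1ℤ ≡.refl)

  sum< : ℕ → (ℕ → ℤ) → ℤ
  sum< zero    f = 0ℤ
  sum< (suc n) f = f 0 + sum< n (λ j → f (suc j))

  sum<-cong : ∀ n {f g} → (∀ j → f j ≡ g j) → sum< n f ≡ sum< n g
  sum<-cong zero    f≗g = ≡.refl
  sum<-cong (suc n) f≗g = ≡.cong₂ _+_ (f≗g 0) (sum<-cong n (λ j → f≗g (suc j)))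

  sum<-- : ∀ n f g → sum< n (λ j → f j - g j) ≡ sum< n f - sum< n g
  sum<-- zero    f g = ≡.refl
  sum<-- (suc n) f g = begin
    (f 0 - g 0) + sum< n (λ j → f (suc j) - g (suc j))  ≡⟨ ≡.cong (_+_ (f 0 - g 0)) (sum<-- n _ _) ⟩
    (f 0 - g 0) + (sum< n _ - sum< n _)                  ≡⟨ eq (f 0) (g 0) (sum< n _) (sum< n _) ⟩
    (f 0 + sum< n _) - (g 0 + sum< n _)                  ∎
    where
    open ≡.≡-Reasoning
    eq : ∀ a b c d → (a - b) + (c - d) ≡ (a + c) - (b + d)
    eq = solve-∀

  sum<-suc : ∀ n f → sum< (suc n) f ≡ sum< n f + f n
  sum<-suc zero    f = ℤₚ.+-comm (f 0) 0ℤ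
  sum<-suc (suc n) f = ≡.trans (≡.cong (_+_ (f 0)) (sum<-suc n (λ j → f (suc j)))) (≡.sym (ℤₚ.+-assoc (f 0) _ _))

  sum<-≡0-mod : ∀ {p} n f → (∀ j → j < n → f j ≡ 0ℤ mod p) → sum< n f ≡ 0ℤ mod p
  sum<-≡0-mod zero    f f≡0 = ≡-mod-refl
  sum<-≡0-mod (suc n) f f≡0 =
    ≡-mod-+ (f≡0 0 (s≤s z≤n)) (sum<-≡0-mod n _ (λ j j<n → f≡0 (suc j) (s≤s j<n)))

  -- altC k j is the coefficient of Xʲ in (1 - X)ᵏ.
  altC : ℕ → ℕ → ℤ
  altC zero    zero    = 1ℤ
  altC zero    (suc j) = 0ℤ
  altC (suc k) zero    = altC k zero
  altC (suc k) (suc j) = altC k (suc j) - altC k j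

  altC-zero : ∀ k → altC k 0 ≡ 1ℤ
  altC-zero zero    = ≡.refl
  altC-zero (suc k) = altC-zero k

  altC-> : ∀ {k j} → k < j → altC k j ≡ 0ℤ
  altC-> {zero}  {suc j} _         = ≡.refl
  altC-> {suc k} {suc j} (s≤s k<j) = ≡.cong₂ _-_ (altC-> (ℕₚ.m<n⇒m<1+n k<j)) (altC-> k<j)

  altC≡±C : ∀ k j → altC k j ≡ -1ℤ ^ℤ j * + (k C j)
  altC≡±C zero    zero    = ≡.refl
  altC≡±C zero    (suc j) = ≡.sym (ℤₚ.*-zeroʳ (-1ℤ ^ℤ suc j))
  altC≡±C (suc k) zero    = altC≡±C k zero
  altC≡±C (suc k) (suc j) = begin
    altC k (suc j) - altC k j                                 ≡⟨ ≡.cong₂ _-_ (altC≡±C k (suc j)) (altC≡±C k j) ⟩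
    -1ℤ * s * + (k C suc j) - s * + (k C j)                    ≡⟨ eq s (+ (k C j)) (+ (k C suc j)) ⟩
    -1ℤ * s * (+ (k C j) + + (k C suc j))                      ≡⟨ ≡.cong (-1ℤ * s *_) (≡.sym (ℤₚ.pos-+ (k C j) (k C suc j))) ⟩
    -1ℤ * s * + (k C j ℕ.+ k C suc j)                          ≡⟨ ≡.cong (λ m → -1ℤ * s * + m) (nCk+nC[k+1]≡[n+1]C[k+1] k j) ⟩
    -1ℤ * s * + (suc k C suc j)                                ∎
    where
    open ≡.≡-Reasoning
    s = -1ℤ ^ℤ j
    eq : ∀ s a b → -1ℤ * s * b - s * a ≡ -1ℤ * s * (a + b)
    eq = solve-∀

  ∑altC : ℕ → ℕ → (ℕ → ℤ) → ℤ
  ∑altC n k f = sum< n (λ j → altC k j * f j)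

  ∑altC-cong : ∀ n k {f g} → (∀ j → f j ≡ g j) → ∑altC n k f ≡ ∑altC n k g
  ∑altC-cong n k f≗g = sum<-cong n (λ j → ≡.cong (altC k j *_) (f≗g j))

  ∑altC-suc : ∀ n k f → ∑altC (suc n) (suc k) f ≡ ∑altC (suc n) k f - ∑altC n k (λ j → f (suc j))
  ∑altC-suc n k f = begin
    altC k 0 * f 0 + sum< n (λ j → (altC k (suc j) - altC k j) * f (suc j))
      ≡⟨ ≡.cong (_+_ (altC k 0 * f 0)) (sum<-cong n (λ j → *-distribʳ-- (altC k (suc j)) (altC k j) (f (suc j)))) ⟩
    altC k 0 * f 0 + sum< n (λ j → altC k (suc j) * f (suc j) - altC k j * f (suc j))
      ≡⟨ ≡.cong (_+_ (altC k 0 * f 0)) (sum<-- n _ _) ⟩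
    altC k 0 * f 0 + (sum< n (λ j → altC k (suc j) * f (suc j)) - ∑altC n k (λ j → f (suc j)))
      ≡⟨ ≡.sym (ℤₚ.+-assoc (altC k 0 * f 0) _ _) ⟩
    ∑altC (suc n) k f - ∑altC n k (λ j → f (suc j))
      ∎
    where
    open ≡.≡-Reasoning
    *-distribʳ-- : ∀ a b c → (a - b) * c ≡ a * c - b * c
    *-distribʳ-- = solve-∀

  ∑altC-beyond : ∀ k f → ∑altC (suc (suc k)) k f ≡ ∑altC (suc k) k f
  ∑altC-beyond k f = begin
    ∑altC (suc (suc k)) k f                    ≡⟨ sum<-suc (suc k) (λ j → altC k j * f j) ⟩
    ∑altC (suc k) k f + altC k (suc k) * f (suc k) ≡⟨ ≡.cong (λ c → ∑altC (suc k) k f + c * f (suc k)) (altC-> (ℕₚ.n<1+n k)) ⟩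
    ∑altC (suc k) k f + 0ℤ                     ≡⟨ ℤₚ.+-identityʳ _ ⟩
    ∑altC (suc k) k f                          ∎
    where open ≡.≡-Reasoning

  ∑altC-prime : ∀ {p} → Prime p → ∀ f → ∑altC (suc p) p f ≡ f 0 - f p mod p
  ∑altC-prime {zero} p-prime = ⊥-elim (¬prime[0] p-prime)
  ∑altC-prime {p@(suc m)} p-prime f = begin
    altC p 0 * f 0 + sum< (suc m) g     ≡⟨ ≡.cong₂ _+_ (≡.cong (_* f 0) (altC-zero p)) (sum<-suc m g) ⟩
    1ℤ * f 0 + (sum< m g + g m)         ≈⟨ ≡-mod-+ (≡-mod-refl {x = 1ℤ * f 0}) (≡-mod-+ inner last) ⟩
    1ℤ * f 0 + (0ℤ + -1ℤ * f p)         ≡⟨ eq (f 0) (f p) ⟩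
    f 0 - f p                           ∎
    where
    open import Relation.Binary.Reasoning.Setoid (≡-mod-setoid p)
    g : ℕ → ℤ
    g j = altC p (suc j) * f (suc j)
    inner : sum< m g ≡ 0ℤ mod p
    inner = sum<-≡0-mod m g λ j j<m → ∣⇒≡0-mod (ℤ∣.∣m⇒∣m*n (f (suc j))
      (≡.subst (+ p ℤ∣.∣_) (≡.sym (altC≡±C p (suc j)))
        (ℤ∣.∣n⇒∣m*n (-1ℤ ^ℤ suc j) (ℤ∣.∣ᵤ⇒∣ (p∣pCk p-prime (s≤s z≤n) (s≤s j<m))))))
    last : g m ≡ -1ℤ * f p mod p
    last = ≡-mod-*ʳ (f p) (≡-mod-trans
      (≡-mod-reflexive (≡.trans (altC≡±C p p) (≡.trans (≡.cong (λ c → -1ℤ ^ℤ p * + c) (nCn≡1 p)) (ℤₚ.*-identityʳ _))))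
      (-1^p≡-1-mod-p p-prime))
    eq : ∀ a b → 1ℤ * a + (0ℤ + -1ℤ * b) ≡ a - b
    eq = solve-∀

LeastPositive : ∀ {ℓ} → (ℕ → Set ℓ) → ℕ → Set ℓ
LeastPositive P n = 0 < n × P n × (∀ b → 0 < b → b < n → ¬ P b)

module _ {ℓ} {P : ℕ → Set ℓ} (P? : ∀ n → Dec (P n)) where

  private
    search : ∀ v → (∀ b → 0 < b → b ≤ v → ¬ P b) ⊎ ∃ (LeastPositive P)
    search zero = inj₁ λ { _ () z≤n }
    search (suc v) with search v
    ... | inj₂ found = inj₂ found
    ... | inj₁ none with P? (suc v)
    ...   | yes Pv = inj₂ (suc v , s≤s z≤n , Pv , λ b 0<b b<1+v → none b 0<b (ℕₚ.≤-pred b<1+v))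
    ...   | no ¬Pv = inj₁ λ b 0<b b≤1+v → [ (λ b<1+v → none b 0<b (ℕₚ.≤-pred b<1+v))
                                         , (λ { ≡.refl → ¬Pv }) ]′ (ℕₚ.m≤n⇒m<n∨m≡n b≤1+v)

  leastPositive : ∀ {n} → 0 < n → P n → ∃ (LeastPositive P)
  leastPositive {n} 0<n Pn with search n
  ... | inj₁ none  = ⊥-elim (none n 0<n ℕₚ.≤-refl Pn)
  ... | inj₂ found = found

∣p^k⇒≡p^j : ∀ {p} → Prime p → ∀ k {d} → d ℕ∣.∣ p ^ k → ∃ λ j → d ≡ p ^ j
∣p^k⇒≡p^j p-prime zero d∣1 = 0 , ℕ∣.∣1⇒≡1 d∣1
∣p^k⇒≡p^j {p} p-prime (suc k) {d} d∣pᵏ⁺¹ with p ℕ∣.∣? d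
... | yes (ℕ∣.divides t ≡.refl)
      with ∣p^k⇒≡p^j p-prime k {t} (ℕ∣.*-cancelʳ-∣ p {{prime⇒nonZero p-prime}}
             (≡.subst (t ℕ.* p ℕ∣.∣_) (ℕₚ.*-comm p (p ^ k)) d∣pᵏ⁺¹))
...   | j , ≡.refl = suc j , ℕₚ.*-comm (p ^ j) p
∣p^k⇒≡p^j {p} p-prime (suc k) {d} d∣pᵏ⁺¹ | no p∤d = ∣p^k⇒≡p^j p-prime k (coprime-divisor d⊥p d∣pᵏ⁺¹)
  where
  d⊥p : Coprime d p
  d⊥p (i∣d , i∣p) with prime⇒irreducible p-prime i∣p
  ... | inj₁ i≡1    = i≡1
  ... | inj₂ ≡.refl = ⊥-elim (p∤d i∣d)

^-∸-split : ∀ b {m n} → m ≤ n → b ^ n ≡ b ^ (n ∸ m) ℕ.* b ^ m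
^-∸-split b {m} {n} m≤n = ≡.trans (≡.cong (b ^_) (≡.sym (ℕₚ.m∸n+n≡m m≤n))) (ℕₚ.^-distribˡ-+-* b (n ∸ m) m)

¬¬-All : ∀ {a b} {A : Set a} {P : A → Set b} xs → (∀ x → ¬ ¬ P x) → ¬ ¬ All P xs
¬¬-All []       ¬¬P ¬all = ¬all []
¬¬-All (x ∷ xs) ¬¬P ¬all = ¬¬P x λ Px → ¬¬-All xs ¬¬P λ Pxs → ¬all (Px ∷ Pxs)

⊆-++⁻ : ∀ {a} {A : Set a} (xs ys : List A) {U} → U ⊆ xs ++ ys →
        Σ (List A) λ U₁ → Σ (List A) λ U₂ → U ≡ U₁ ++ U₂ × U₁ ⊆ xs × U₂ ⊆ ys
⊆-++⁻ []       ys U⊆ = [] , _ , ≡.refl , [] , U⊆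
⊆-++⁻ (x ∷ xs) ys (.x ∷ʳ U⊆) with ⊆-++⁻ xs ys U⊆
... | U₁ , U₂ , ≡.refl , U₁⊆ , U₂⊆ = U₁ , U₂ , ≡.refl , x ∷ʳ U₁⊆ , U₂⊆
⊆-++⁻ (x ∷ xs) ys (≡.refl ∷ U⊆) with ⊆-++⁻ xs ys U⊆
... | U₁ , U₂ , ≡.refl , U₁⊆ , U₂⊆ = x ∷ U₁ , U₂ , ≡.refl , ≡.refl ∷ U₁⊆ , U₂⊆

⊆-replicate⁻ : ∀ {a} {A : Set a} n (x : A) {U} → U ⊆ replicate n x → Σ ℕ λ m → m ≤ n × U ≡ replicate m x
⊆-replicate⁻ zero    x []           = 0 , z≤n , ≡.refl
⊆-replicate⁻ (suc n) x (.x ∷ʳ U⊆) with ⊆-replicate⁻ n x U⊆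
... | m , m≤n , ≡.refl = m , ℕₚ.m≤n⇒m≤1+n m≤n , ≡.refl
⊆-replicate⁻ (suc n) x (≡.refl ∷ U⊆) with ⊆-replicate⁻ n x U⊆
... | m , m≤n , ≡.refl = suc m , s≤s m≤n , ≡.refl

replicate-+ : ∀ {a} {A : Set a} m n (x : A) → replicate (m ℕ.+ n) x ≡ replicate m x ++ replicate n x
replicate-+ zero    n x = ≡.refl
replicate-+ (suc m) n x = ≡.cong (x ∷_) (replicate-+ m n x)

module Multiples {c ℓ : Level} (G : AbelianGroup c ℓ) where
  open AbelianGroup G
  open import Algebra.Properties.CommutativeMonoid.Mult commutativeMonoid public
    using (×-congʳ; ×-homo-+; ×-assocˡ; ×-distrib-+) renaming (_×_ to _·_)
  open import Algebra.Properties.CommutativeSemigroup commutativeSemigroup public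
    using (interchange; x∙yz≈y∙xz)
  open import Algebra.Properties.Group group using (⁻¹-anti-homo-∙; ε⁻¹≈ε)

  mulℕ≡· : ∀ n x → mulℕ G n x ≡ n · x
  mulℕ≡· zero    x = ≡.refl
  mulℕ≡· (suc n) x = ≡.cong (x ∙_) (mulℕ≡· n x)

  ·-ε : ∀ n → n · ε ≈ ε
  ·-ε zero    = refl
  ·-ε (suc n) = trans (identityˡ _) (·-ε n)

  ·-⁻¹ : ∀ n x → n · (x ⁻¹) ≈ (n · x) ⁻¹
  ·-⁻¹ zero    x = sym ε⁻¹≈ε
  ·-⁻¹ (suc n) x = trans (∙-congˡ (·-⁻¹ n x)) (trans (comm _ _) (sym (⁻¹-anti-homo-∙ x (n · x))))

  ·-*-annihilates : ∀ m n {x} → m · x ≈ ε → (n ℕ.* m) · x ≈ ε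
  ·-*-annihilates m n {x} m·x≈ε =
    trans (sym (×-assocˡ x n m)) (trans (×-congʳ n m·x≈ε) (·-ε n))

  ·-annihilates-mono : ∀ b {m n} → m ≤ n → ∀ {x} → (b ^ m) · x ≈ ε → (b ^ n) · x ≈ ε
  ·-annihilates-mono b {m} {n} m≤n {x} bᵐx≈ε =
    ≡.subst (λ e → e · x ≈ ε) (≡.sym (^-∸-split b m≤n)) (·-*-annihilates (b ^ m) (b ^ (n ∸ m)) bᵐx≈ε)

  ·-mod : ∀ {g N} → N · g ≈ ε → .{{_ : NonZero N}} → ∀ b → b · g ≈ (b % N) · g
  ·-mod {g} {N} N·g≈ε b = begin
    b · g                                  ≡⟨ ≡.cong (_· g) (m≡m%n+[m/n]*n b N) ⟩
    (b % N ℕ.+ (b / N) ℕ.* N) · g          ≈⟨ ×-homo-+ g (b % N) _ ⟩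
    (b % N) · g ∙ ((b / N) ℕ.* N) · g      ≈⟨ ∙-congˡ (·-*-annihilates N (b / N) N·g≈ε) ⟩
    (b % N) · g ∙ ε                        ≈⟨ identityʳ _ ⟩
    (b % N) · g                            ∎
    where open import Relation.Binary.Reasoning.Setoid setoid

  σ-++ : ∀ xs ys → σ G (xs ++ ys) ≈ σ G xs ∙ σ G ys
  σ-++ []       ys = sym (identityˡ _)
  σ-++ (x ∷ xs) ys = trans (∙-congˡ (σ-++ xs ys)) (sym (assoc _ _ _))

  σ-replicate : ∀ n x → σ G (replicate n x) ≡ n · x
  σ-replicate zero    x = ≡.refl
  σ-replicate (suc n) x = ≡.cong (x ∙_) (σ-replicate n x)

-- Orders, quotients by cyclic subgroups, and bases

module Order {c ℓ : Level} (G : AbelianGroup c ℓ) where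
  open AbelianGroup G
  open Multiples G

  IsOrder : Carrier → ℕ → Set ℓ
  IsOrder g = LeastPositive (λ b → b · g ≈ ε)

  order-∣ : ∀ {g N} → IsOrder g N → ∀ {b} → b · g ≈ ε → N ℕ∣.∣ b
  order-∣ {g} {N@(suc _)} (_ , N·g≈ε , minimal) {b} b·g≈ε with b % N in b%N≡
  ... | zero  = ℕ∣.divides (b / N) (≡.trans (m≡m%n+[m/n]*n b N) (≡.cong (ℕ._+ (b / N) ℕ.* N) b%N≡))
  ... | suc r = ⊥-elim (minimal (suc r) (s≤s z≤n) (≡.subst (_< N) b%N≡ (m%n<n b N))
                  (trans (sym (reflexive (≡.cong (_· g) b%N≡))) (trans (sym (·-mod N·g≈ε b)) b·g≈ε)))

  order-minimal : ∀ {g N} → IsOrder g N → ∀ {b} → b < N → b · g ≈ ε → b ≡ 0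
  order-minimal _                    {zero}  _   _     = ≡.refl
  order-minimal (_ , _ , minimal) {suc b} b<N b·g≈ε = ⊥-elim (minimal (suc b) (s≤s z≤n) b<N b·g≈ε)

  module _ (_≟_ : Decidable _≈_) {p} (p-prime : Prime p) where

    -- Opaque: only the existence of the order is used later, and unfolding the search
    -- makes checking the basis construction very slow.
    opaque
      order : ∀ K {g} → (p ^ K) · g ≈ ε → ∃ λ k → IsOrder g (p ^ k)
      order K {g} pᴷg≈ε with leastPositive (λ b → (b · g) ≟ ε) (ℕₚ.m^n>0 p {{prime⇒nonZero p-prime}} K) pᴷg≈ε
      ... | N , isOrder with ∣p^k⇒≡p^j p-prime K (order-∣ isOrder pᴷg≈ε)
      ...   | k , ≡.refl = k , isOrder

module Quotient {c ℓ : Level} (G : AbelianGroup c ℓ) (z : AbelianGroup.Carrier G) where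
  open AbelianGroup G
  open Multiples G
  open import Algebra.Properties.Group group using (inverseʳ-unique)
  open import Relation.Binary.Reasoning.Setoid setoid

  infix 4 _~_
  _~_ : Carrier → Carrier → Set ℓ
  x ~ y = ∃ λ i → x ≈ y ∙ i · z

  ≈⇒~ : ∀ {x y} → x ≈ y → x ~ y
  ≈⇒~ x≈y = 0 , trans x≈y (sym (identityʳ _))

  module _ {E} (E·z≈ε : E · z ≈ ε) .{{_ : NonZero E}} where

    ⁻¹-·-multiple : ∀ i → (i · z) ⁻¹ ≈ ((E ∸ 1) ℕ.* i) · z
    ⁻¹-·-multiple i = sym (inverseʳ-unique (i · z) _ (begin
      i · z ∙ ((E ∸ 1) ℕ.* i) · z  ≈⟨ ×-homo-+ z i _ ⟨
      (i ℕ.+ (E ∸ 1) ℕ.* i) · z    ≡⟨ ≡.cong (λ n → (n ℕ.* i) · z) (ℕₚ.m+[n∸m]≡n {1} {E} (>-nonZero⁻¹ E)) ⟩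
      (E ℕ.* i) · z                ≈⟨ ≡.subst (λ n → n · z ≈ ε) (ℕₚ.*-comm i E) (·-*-annihilates E i E·z≈ε) ⟩
      ε                            ∎))

    ~-sym : ∀ {x y} → x ~ y → y ~ x
    ~-sym {x} {y} (i , x≈) = (E ∸ 1) ℕ.* i , (begin
      y                          ≈⟨ identityʳ y ⟨
      y ∙ ε                      ≈⟨ ∙-congˡ (inverseʳ (i · z)) ⟨
      y ∙ (i · z ∙ (i · z) ⁻¹)   ≈⟨ assoc y _ _ ⟨
      (y ∙ i · z) ∙ (i · z) ⁻¹   ≈⟨ ∙-cong (sym x≈) (⁻¹-·-multiple i) ⟩
      x ∙ ((E ∸ 1) ℕ.* i) · z    ∎)

    ~-trans : ∀ {x y w} → x ~ y → y ~ w → x ~ w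
    ~-trans {x} {y} {w} (i , x≈) (j , y≈) = j ℕ.+ i , (begin
      x                  ≈⟨ x≈ ⟩
      y ∙ i · z          ≈⟨ ∙-congʳ y≈ ⟩
      (w ∙ j · z) ∙ i · z ≈⟨ assoc w _ _ ⟩
      w ∙ (j · z ∙ i · z) ≈⟨ ∙-congˡ (×-homo-+ z j i) ⟨
      w ∙ (j ℕ.+ i) · z  ∎)

    ~-∙ : ∀ {x y u v} → x ~ y → u ~ v → x ∙ u ~ y ∙ v
    ~-∙ {x} {y} {u} {v} (i , x≈) (j , u≈) = i ℕ.+ j , (begin
      x ∙ u                      ≈⟨ ∙-cong x≈ u≈ ⟩
      (y ∙ i · z) ∙ (v ∙ j · z)  ≈⟨ interchange y _ v _ ⟩
      (y ∙ v) ∙ (i · z ∙ j · z)  ≈⟨ ∙-congˡ (×-homo-+ z i j) ⟨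
      (y ∙ v) ∙ (i ℕ.+ j) · z    ∎)

    ~-⁻¹ : ∀ {x y} → x ~ y → x ⁻¹ ~ y ⁻¹
    ~-⁻¹ {x} {y} (i , x≈) = (E ∸ 1) ℕ.* i , (begin
      x ⁻¹                         ≈⟨ ⁻¹-cong x≈ ⟩
      (y ∙ i · z) ⁻¹               ≈⟨ ⁻¹-∙-comm y (i · z) ⟨
      y ⁻¹ ∙ (i · z) ⁻¹            ≈⟨ ∙-congˡ (⁻¹-·-multiple i) ⟩
      y ⁻¹ ∙ ((E ∸ 1) ℕ.* i) · z   ∎)
      where open import Algebra.Properties.AbelianGroup G using (⁻¹-∙-comm)

    G/⟨z⟩ : AbelianGroup c ℓ
    G/⟨z⟩ = record
      { Carrier        = Carrier
      ; _≈_            = _~_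
      ; _∙_            = _∙_
      ; ε              = ε
      ; _⁻¹            = _⁻¹
      ; isAbelianGroup = record
        { isGroup = record
          { isMonoid = record
            { isSemigroup = record
              { isMagma = record
                { isEquivalence = record { refl = ≈⇒~ refl ; sym = ~-sym ; trans = ~-trans }
                ; ∙-cong        = ~-∙
                }
              ; assoc = λ x y w → ≈⇒~ (assoc x y w)
              }
            ; identity = (λ x → ≈⇒~ (identityˡ x)) , (λ x → ≈⇒~ (identityʳ x))
            }
          ; inverse = (λ x → ≈⇒~ (inverseˡ x)) , (λ x → ≈⇒~ (inverseʳ x))
          ; ⁻¹-cong = ~-⁻¹
          }
        ; comm = λ x y → ≈⇒~ (comm x y)
        }
      }

    ·-G/⟨z⟩ : ∀ n x → Multiples._·_ G/⟨z⟩ n x ≡ n · x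
    ·-G/⟨z⟩ zero    x = ≡.refl
    ·-G/⟨z⟩ (suc n) x = ≡.cong (x ∙_) (·-G/⟨z⟩ n x)

    ~-decidable : Decidable _≈_ → Decidable _~_
    ~-decidable _≟_ x y with ℕₚ.anyUpTo? (λ i → x ≟ (y ∙ i · z)) E
    ... | yes (i , _ , x≈) = yes (i , x≈)
    ... | no  ∄i<E         = no λ (i , x≈) →
      ∄i<E (i % E , m%n<n i E , trans x≈ (∙-congˡ (·-mod E·z≈ε i)))

module Combinations {c ℓ : Level} (G : AbelianGroup c ℓ) (p : ℕ) where
  open AbelianGroup G
  open Multiples G

  -- Missing coefficients count as 0 and surplus ones are ignored.
  lincomb : List (Carrier × ℕ) → List ℕ → Carrier
  lincomb []            _        = ε
  lincomb (_ ∷ _)       []       = ε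
  lincomb ((e , _) ∷ B) (b ∷ bs) = b · e ∙ lincomb B bs

  InSpan : List (Carrier × ℕ) → Carrier → Set ℓ
  InSpan B x = Σ (List ℕ) λ bs → x ≈ lincomb B bs

  Annihilates : List (Carrier × ℕ) → Set (c ⊔ ℓ)
  Annihilates = All (λ (e , l) → (p ^ l) · e ≈ ε)

  Bounded : List (Carrier × ℕ) → List ℕ → Set c
  Bounded B bs = Pointwise (λ b (_ , l) → b < p ^ l) bs B

  Independent : List (Carrier × ℕ) → Set (c ⊔ ℓ)
  Independent B = ∀ bs → Bounded B bs → lincomb B bs ≈ ε → All (_≡ 0) bs

  -- A basis is a list of pairs (e , l) with e of order pˡ, so that G ≅ ⊕ ℤ/pˡ.
  record Basis : Set (c ⊔ ℓ) where
    field
      elements    : List (Carrier × ℕ)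
      spans       : ∀ x → InSpan elements x
      annihilates : Annihilates elements
      independent : Independent elements

  D* : List (Carrier × ℕ) → ℕ
  D* []            = 0
  D* ((_ , l) ∷ B) = (p ^ l ∸ 1) ℕ.+ D* B

  lincomb-zeros : ∀ B {bs} → All (_≡ 0) bs → lincomb B bs ≈ ε
  lincomb-zeros []            _                = refl
  lincomb-zeros (_ ∷ _)       []               = refl
  lincomb-zeros ((e , l) ∷ B) (≡.refl ∷ bs≡0) = trans (identityˡ _) (lincomb-zeros B bs≡0)

  InSpan-∷⁻ : ∀ {e l B x} → InSpan ((e , l) ∷ B) x → Σ ℕ λ a → Σ Carrier λ y → InSpan B y × x ≈ a · e ∙ y
  InSpan-∷⁻ {B = B} ([] , x≈ε) = 0 , ε , ([] , sym (lincomb-zeros B [])) , trans x≈ε (sym (identityˡ ε))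
  InSpan-∷⁻ {B = B} (b ∷ bs , x≈) = b , lincomb B bs , (bs , refl) , x≈

module BasisTheorem {c ℓ : Level} {p : ℕ} (p-prime : Prime p) where
  private instance
    p≢0 : NonZero p
    p≢0 = prime⇒nonZero p-prime

  module _ (G : AbelianGroup c ℓ) where
    open AbelianGroup G
    open Multiples G

    data Generated (gs : List Carrier) : Carrier → Set (c ⊔ ℓ) where
      generated-ε : ∀ {x} → x ≈ ε → Generated gs x
      generated-∙ : ∀ {x g y} → g ∈ gs → Generated gs y → x ≈ g ∙ y → Generated gs x

    Generated-resp : ∀ {gs x y} → x ≈ y → Generated gs y → Generated gs x
    Generated-resp x≈y (generated-ε y≈ε)       = generated-ε (trans x≈y y≈ε)
    Generated-resp x≈y (generated-∙ g∈ gen y≈) = generated-∙ g∈ gen (trans x≈y y≈)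

    HasExponent : ℕ → Set (c ⊔ ℓ)
    HasExponent K = ∀ x → (p ^ K) · x ≈ ε

  HasBasisFor : ℕ → Set (Level.suc (c ⊔ ℓ))
  HasBasisFor n = ∀ H → Decidable (AbelianGroup._≈_ H) → ∀ {K} → HasExponent H K →
                  ∀ gs → length gs ≤ n → (∀ x → Generated H gs x) → Combinations.Basis H p

  module Step (G : AbelianGroup c ℓ) (_≟_ : Decidable (AbelianGroup._≈_ G)) {K : ℕ} (exponent : HasExponent G K)
              (g₀ : AbelianGroup.Carrier G) (gs₀ : List (AbelianGroup.Carrier G))
              (generated : ∀ x → Generated G (g₀ ∷ gs₀) x)
              {n : ℕ} (|gs₀|≤n : length gs₀ ≤ n) (basis-for-fewer : HasBasisFor n) where
    open AbelianGroup G
    open Multiples G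
    open Combinations G p
    open Order G

    ord : Carrier → ℕ
    ord g = proj₁ (order _≟_ p-prime K (exponent g))

    ord-isOrder : ∀ g → IsOrder g (p ^ ord g)
    ord-isOrder g = proj₂ (order _≟_ p-prime K (exponent g))

    z : Carrier
    z = argmax ord g₀ gs₀

    k : ℕ
    k = ord z

    pᵏz≈ε : (p ^ k) · z ≈ ε
    pᵏz≈ε = proj₁ (proj₂ (ord-isOrder z))

    z∈gs : z ∈ g₀ ∷ gs₀
    z∈gs with argmax-sel ord g₀ gs₀
    ... | inj₁ z≡g₀  = here z≡g₀
    ... | inj₂ z∈gs₀ = there z∈gs₀

    ord≤k : ∀ {g} → g ∈ g₀ ∷ gs₀ → ord g ≤ k
    ord≤k (here ≡.refl)  = f[⊥]≤f[argmax] {f = ord} g₀ gs₀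
    ord≤k (there g∈gs₀) = All.lookup (f[xs]≤f[argmax] {f = ord} g₀ gs₀) g∈gs₀

    pᵏ-annihilates : ∀ x → (p ^ k) · x ≈ ε
    pᵏ-annihilates x = annihilated (generated x)
      where
      annihilated : ∀ {x} → Generated G (g₀ ∷ gs₀) x → (p ^ k) · x ≈ ε
      annihilated (generated-ε x≈ε) = trans (×-congʳ (p ^ k) x≈ε) (·-ε (p ^ k))
      annihilated (generated-∙ {w} {g} {y} g∈ gen w≈) = begin
        (p ^ k) · w                   ≈⟨ ×-congʳ (p ^ k) w≈ ⟩
        (p ^ k) · (g ∙ y)             ≈⟨ ×-distrib-+ g y (p ^ k) ⟩
        (p ^ k) · g ∙ (p ^ k) · y     ≈⟨ ∙-cong (·-annihilates-mono p (ord≤k g∈) (proj₁ (proj₂ (ord-isOrder g)))) (annihilated gen) ⟩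
        ε ∙ ε                         ≈⟨ identityˡ ε ⟩
        ε                             ∎
        where open import Relation.Binary.Reasoning.Setoid setoid

    open Quotient G z

    private instance
      pᵏ≢0 : NonZero (p ^ k)
      pᵏ≢0 = ℕₚ.m^n≢0 p k

    Q : AbelianGroup c ℓ
    Q = G/⟨z⟩ pᵏz≈ε

    open Combinations Q p using () renaming
      (Basis to BasisQ; lincomb to lincombQ; Annihilates to AnnihilatesQ; Bounded to BoundedQ)

    gs′ : List Carrier
    gs′ = proj₁ (∈-∃++ z∈gs) ++ proj₁ (proj₂ (∈-∃++ z∈gs))

    |gs′|≤n : length gs′ ≤ n
    |gs′|≤n with ∈-∃++ z∈gs
    ... | A , R , gs≡ = ≡.subst (_≤ n) (ℕₚ.suc-injective |gs|≡) |gs₀|≤n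
      where
      |gs|≡ : suc (length gs₀) ≡ suc (length (A ++ R))
      |gs|≡ = ≡.trans (≡.cong length gs≡) (Listₚ.length-++-sucʳ A z R)

    ∈gs⇒≡z⊎∈gs′ : ∀ {g} → g ∈ g₀ ∷ gs₀ → g ≡ z ⊎ g ∈ gs′
    ∈gs⇒≡z⊎∈gs′ g∈ with ∈-∃++ z∈gs
    ... | A , R , gs≡ with ∈-++⁻ A (≡.subst (_ ∈_) gs≡ g∈)
    ...   | inj₁ g∈A         = inj₂ (∈-++⁺ˡ g∈A)
    ...   | inj₂ (here g≡z)  = inj₁ g≡z
    ...   | inj₂ (there g∈R) = inj₂ (∈-++⁺ʳ A g∈R)

    generatedQ : ∀ {x} → Generated G (g₀ ∷ gs₀) x → Generated Q gs′ x
    generatedQ (generated-ε x≈ε) = generated-ε (≈⇒~ x≈ε)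
    generatedQ (generated-∙ {x} {y = y} g∈ gen x≈) with ∈gs⇒≡z⊎∈gs′ g∈
    ... | inj₁ ≡.refl = Generated-resp Q (1 , trans x≈ (trans (comm z y) (∙-congˡ (sym (identityʳ z)))))
                                          (generatedQ gen)
    ... | inj₂ g∈gs′  = generated-∙ g∈gs′ (generatedQ gen) (≈⇒~ x≈)

    basisQ : BasisQ
    basisQ = basis-for-fewer Q (~-decidable pᵏz≈ε _≟_) {k}
      (λ x → ≡.subst (_~ ε) (≡.sym (·-G/⟨z⟩ pᵏz≈ε (p ^ k) x)) (≈⇒~ (pᵏ-annihilates x)))
      gs′ |gs′|≤n (λ x → generatedQ (generated x))

    Lifts : Carrier × ℕ → Carrier × ℕ → Set ℓ
    Lifts (f , l) (f′ , l′) = l ≡ l′ × ∃ λ i → f ≈ f′ ∙ i · z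

    -- If pˡ·f = i·z, then pᵏ divides pᵏ⁻ˡ·i since pᵏ annihilates f; so i = j·pˡ, and
    -- f - j·z represents f and is annihilated by pˡ (if l > k, f itself is).
    lift : ∀ {f l} → (p ^ l) · f ~ ε → ∃ λ f′ → Lifts (f , l) (f′ , l) × (p ^ l) · f′ ≈ ε
    lift {f} {l} pˡf~ε with l ≤? k
    ... | no  l≰k = f , (≡.refl , 0 , sym (identityʳ f)) ,
                    ·-annihilates-mono p (ℕₚ.<⇒≤ (ℕₚ.≰⇒> l≰k)) (pᵏ-annihilates f)
    ... | yes l≤k with pˡf~ε
    ...   | i , pˡf≈ = f ∙ (j · z) ⁻¹ , (≡.refl , j , sym f′∙jz≈f) , pˡf′≈ε
      where
      open import Relation.Binary.Reasoning.Setoid setoid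
      pᵏ⁻ˡi·z≈ε : (p ^ (k ∸ l) ℕ.* i) · z ≈ ε
      pᵏ⁻ˡi·z≈ε = begin
        (p ^ (k ∸ l) ℕ.* i) · z       ≈⟨ ×-assocˡ z (p ^ (k ∸ l)) i ⟨
        (p ^ (k ∸ l)) · i · z         ≈⟨ ×-congʳ (p ^ (k ∸ l)) (trans pˡf≈ (identityˡ _)) ⟨
        (p ^ (k ∸ l)) · (p ^ l) · f   ≈⟨ ×-assocˡ f (p ^ (k ∸ l)) (p ^ l) ⟩
        (p ^ (k ∸ l) ℕ.* p ^ l) · f   ≡⟨ ≡.cong (_· f) (^-∸-split p l≤k) ⟨
        (p ^ k) · f                   ≈⟨ pᵏ-annihilates f ⟩
        ε                             ∎
      pˡ∣i : p ^ l ℕ∣.∣ i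
      pˡ∣i = ℕ∣.*-cancelˡ-∣ (p ^ (k ∸ l)) {{ℕₚ.m^n≢0 p (k ∸ l)}}
        (≡.subst (ℕ∣._∣ p ^ (k ∸ l) ℕ.* i) (^-∸-split p l≤k) (order-∣ (ord-isOrder z) pᵏ⁻ˡi·z≈ε))
      j : ℕ
      j = ℕ∣._∣_.quotient pˡ∣i
      f′∙jz≈f : (f ∙ (j · z) ⁻¹) ∙ j · z ≈ f
      f′∙jz≈f = trans (assoc f _ _) (trans (∙-congˡ (inverseˡ (j · z))) (identityʳ f))
      pˡf′≈ε : (p ^ l) · (f ∙ (j · z) ⁻¹) ≈ ε
      pˡf′≈ε = begin
        (p ^ l) · (f ∙ (j · z) ⁻¹)              ≈⟨ ×-distrib-+ f _ (p ^ l) ⟩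
        (p ^ l) · f ∙ (p ^ l) · ((j · z) ⁻¹)    ≈⟨ ∙-cong (trans pˡf≈ (identityˡ _)) (·-⁻¹ (p ^ l) (j · z)) ⟩
        i · z ∙ ((p ^ l) · j · z) ⁻¹            ≈⟨ ∙-congˡ (⁻¹-cong (×-assocˡ z (p ^ l) j)) ⟩
        i · z ∙ ((p ^ l ℕ.* j) · z) ⁻¹          ≡⟨ ≡.cong (λ m → i · z ∙ (m · z) ⁻¹) (≡.trans (ℕₚ.*-comm (p ^ l) j) (≡.sym (ℕ∣._∣_.equality pˡ∣i))) ⟩
        i · z ∙ (i · z) ⁻¹                      ≈⟨ inverseʳ (i · z) ⟩
        ε                                       ∎

    liftAll : ∀ B → AnnihilatesQ B → ∃ λ B′ → Pointwise Lifts B B′ × Annihilates B′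
    liftAll []            []               = [] , [] , []
    liftAll ((f , l) ∷ B) (pˡf~ε ∷ ann) with lift (≡.subst (_~ ε) (·-G/⟨z⟩ pᵏz≈ε (p ^ l) f) pˡf~ε) | liftAll B ann
    ... | f′ , f↑f′ , pˡf′≈ε | B′ , B↑B′ , ann′ = (f′ , l) ∷ B′ , f↑f′ ∷ B↑B′ , pˡf′≈ε ∷ ann′

    lincombQ≡lincomb : ∀ B bs → lincombQ B bs ≡ lincomb B bs
    lincombQ≡lincomb []            _        = ≡.refl
    lincombQ≡lincomb (_ ∷ _)       []       = ≡.refl
    lincombQ≡lincomb ((e , _) ∷ B) (b ∷ bs) = ≡.cong₂ _∙_ (·-G/⟨z⟩ pᵏz≈ε b e) (lincombQ≡lincomb B bs)

    lincomb-lift : ∀ {B B′} → Pointwise Lifts B B′ → ∀ bs → lincomb B bs ~ lincomb B′ bs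
    lincomb-lift []       _        = ≈⇒~ refl
    lincomb-lift (_ ∷ _)  []       = ≈⇒~ refl
    lincomb-lift {(f , _) ∷ B} {(f′ , _) ∷ B′} ((_ , j , f≈) ∷ B↑B′) (b ∷ bs) with lincomb-lift B↑B′ bs
    ... | i , lincomb≈ = b ℕ.* j ℕ.+ i , (begin
      b · f ∙ lincomb B bs                         ≈⟨ ∙-cong (×-congʳ b f≈) lincomb≈ ⟩
      b · (f′ ∙ j · z) ∙ (lincomb B′ bs ∙ i · z)   ≈⟨ ∙-congʳ (×-distrib-+ f′ (j · z) b) ⟩
      (b · f′ ∙ b · j · z) ∙ (lincomb B′ bs ∙ i · z) ≈⟨ interchange _ _ _ _ ⟩
      (b · f′ ∙ lincomb B′ bs) ∙ (b · j · z ∙ i · z) ≈⟨ ∙-congˡ (∙-congʳ (×-assocˡ z b j)) ⟩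
      (b · f′ ∙ lincomb B′ bs) ∙ ((b ℕ.* j) · z ∙ i · z) ≈⟨ ∙-congˡ (×-homo-+ z (b ℕ.* j) i) ⟨
      (b · f′ ∙ lincomb B′ bs) ∙ (b ℕ.* j ℕ.+ i) · z ∎)
      where open import Relation.Binary.Reasoning.Setoid setoid

    Bounded-lift : ∀ {B B′ bs} → Pointwise Lifts B B′ → Bounded B′ bs → Bounded B bs
    Bounded-lift []                      []               = []
    Bounded-lift ((≡.refl , _) ∷ B↑B′) (b<pˡ ∷ bounded) = b<pˡ ∷ Bounded-lift B↑B′ bounded

    open Combinations.Basis basisQ renaming (elements to BQ; spans to spansQ; annihilates to annihilatesQ; independent to independentQ)

    B′ : List (Carrier × ℕ)
    B′ = proj₁ (liftAll BQ annihilatesQ)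

    BQ↑B′ : Pointwise Lifts BQ B′
    BQ↑B′ = proj₁ (proj₂ (liftAll BQ annihilatesQ))

    spans′ : ∀ x → InSpan ((z , k) ∷ B′) x
    spans′ x =
      let bs , x~ = spansQ x
          i , x≈  = ~-trans pᵏz≈ε (≡.subst (x ~_) (lincombQ≡lincomb BQ bs) x~) (lincomb-lift BQ↑B′ bs)
      in  i ∷ bs , trans x≈ (comm _ _)

    independent′ : Independent ((z , k) ∷ B′)
    independent′ []       _                 _     = []
    independent′ (b ∷ bs) (b<pᵏ ∷ bounded) b·z∙≈ε = b≡0 ∷ bs≡0
      where
      lincomb′~ε : lincomb B′ bs ~ ε
      lincomb′~ε = ~-sym pᵏz≈ε (b , trans (sym b·z∙≈ε) (comm _ _))
      bs≡0 : All (_≡ 0) bs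
      bs≡0 = independentQ bs (Bounded-lift BQ↑B′ bounded)
        (≡.subst (_~ ε) (≡.sym (lincombQ≡lincomb BQ bs)) (~-trans pᵏz≈ε (lincomb-lift BQ↑B′ bs) lincomb′~ε))
      b·z≈ε : b · z ≈ ε
      b·z≈ε = trans (sym (identityʳ _)) (trans (∙-congˡ (sym (lincomb-zeros B′ bs≡0))) b·z∙≈ε)
      b≡0 : b ≡ 0
      b≡0 = order-minimal (ord-isOrder z) b<pᵏ b·z≈ε

    basis : Basis
    basis = record
      { elements    = (z , k) ∷ B′
      ; spans       = spans′
      ; annihilates = pᵏz≈ε ∷ proj₂ (proj₂ (liftAll BQ annihilatesQ))
      ; independent = independent′
      }

  hasBasis : ∀ n → HasBasisFor n
  hasBasis _       H _≟_ exponent []         _              generated = record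
    { elements    = []
    ; spans       = λ x → [] , generated-by-[] (generated x)
    ; annihilates = []
    ; independent = λ { [] [] _ → [] }
    }
    where
    generated-by-[] : ∀ {x} → Generated H [] x → AbelianGroup._≈_ H x (AbelianGroup.ε H)
    generated-by-[] (generated-ε x≈ε) = x≈ε
  hasBasis (suc n) H _≟_ {K} exponent (g₀ ∷ gs₀) (s≤s |gs₀|≤n) generated =
    Step.basis H _≟_ {K} exponent g₀ gs₀ generated |gs₀|≤n (hasBasis n)

-- Difference operators and Olson's bound

module Differences {c ℓ : Level} (G : AbelianGroup c ℓ) where
  open import Data.Integer using (_+_; _-_; _*_)
  open AbelianGroup G hiding (_-_)
  open Multiples G

  Fun : Set c
  Fun = Carrier → ℤ

  Cong : Fun → Set (c ⊔ ℓ)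
  Cong = Congruent _≈_ _≡_

  0ᶠ : Fun
  0ᶠ _ = 0ℤ

  infixl 6 _⊕_
  _⊕_ : Fun → Fun → Fun
  (φ ⊕ ψ) a = φ a + ψ a

  τ : Carrier → Fun → Fun
  τ u φ a = φ (u ∙ a)

  Δ : Carrier → Fun → Fun
  Δ t φ a = φ a - φ (t ∙ a)

  Δ* : List Carrier → Fun → Fun
  Δ* T φ = foldr Δ φ T

  τ-cong : ∀ u {φ} → Cong φ → Cong (τ u φ)
  τ-cong u φ-cong x≈y = φ-cong (∙-congˡ x≈y)

  Δ-cong : ∀ t {φ} → Cong φ → Cong (Δ t φ)
  Δ-cong t φ-cong x≈y = ≡.cong₂ _-_ (φ-cong x≈y) (φ-cong (∙-congˡ x≈y))

  Δ*-cong : ∀ T {φ} → Cong φ → Cong (Δ* T φ)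
  Δ*-cong []      φ-cong = φ-cong
  Δ*-cong (t ∷ T) φ-cong = Δ-cong t (Δ*-cong T φ-cong)

  Δ-resp-≗ : ∀ t {φ ψ} → φ ≗ ψ → Δ t φ ≗ Δ t ψ
  Δ-resp-≗ t φ≗ψ a = ≡.cong₂ _-_ (φ≗ψ a) (φ≗ψ (t ∙ a))

  Δ*-resp-≗ : ∀ T {φ ψ} → φ ≗ ψ → Δ* T φ ≗ Δ* T ψ
  Δ*-resp-≗ []      φ≗ψ = φ≗ψ
  Δ*-resp-≗ (t ∷ T) φ≗ψ = Δ-resp-≗ t (Δ*-resp-≗ T φ≗ψ)

  Δ-resp-≈ : ∀ {s t φ} → Cong φ → s ≈ t → Δ s φ ≗ Δ t φ
  Δ-resp-≈ {φ = φ} φ-cong s≈t a = ≡.cong (_-_ (φ a)) (φ-cong (∙-congʳ s≈t))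

  Δ-ε : ∀ {t φ} → Cong φ → t ≈ ε → Δ t φ ≗ 0ᶠ
  Δ-ε {φ = φ} φ-cong t≈ε a =
    ≡.trans (≡.cong (_-_ (φ a)) (φ-cong (trans (∙-congʳ t≈ε) (identityˡ a)))) (ℤₚ.+-inverseʳ (φ a))

  Δ*-0ᶠ : ∀ T → Δ* T 0ᶠ ≗ 0ᶠ
  Δ*-0ᶠ []      a = ≡.refl
  Δ*-0ᶠ (t ∷ T) a = ≡.cong₂ _-_ (Δ*-0ᶠ T a) (Δ*-0ᶠ T (t ∙ a))

  Δ-⊕ : ∀ t φ ψ → Δ t (φ ⊕ ψ) ≗ Δ t φ ⊕ Δ t ψ
  Δ-⊕ t φ ψ a = eq (φ a) (ψ a) (φ (t ∙ a)) (ψ (t ∙ a))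
    where
    eq : ∀ a b c d → (a + b) - (c + d) ≡ (a - c) + (b - d)
    eq = solve-∀

  Δ-∙ : ∀ t u {φ} → Cong φ → Δ (t ∙ u) φ ≗ Δ u φ ⊕ τ u (Δ t φ)
  Δ-∙ t u {φ} φ-cong a = ≡.trans (eq (φ a) (φ (u ∙ a)) (φ ((t ∙ u) ∙ a)))
    (≡.cong (λ z → (φ a - φ (u ∙ a)) + (φ (u ∙ a) - z)) (φ-cong (assoc t u a)))
    where
    eq : ∀ x y z → x - z ≡ (x - y) + (y - z)
    eq = solve-∀

  Δ-comm : ∀ s t {φ} → Cong φ → Δ s (Δ t φ) ≗ Δ t (Δ s φ)
  Δ-comm s t {φ} φ-cong a = ≡.trans (eq (φ a) (φ (t ∙ a)) (φ (s ∙ a)) (φ (t ∙ (s ∙ a))))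
    (≡.cong (λ z → (φ a - φ (s ∙ a)) - (φ (t ∙ a) - z)) (φ-cong (x∙yz≈y∙xz t s a)))
    where
    eq : ∀ a b c d → (a - b) - (c - d) ≡ (a - c) - (b - d)
    eq = solve-∀

  Δ-Δ* : ∀ s U {φ} → Cong φ → Δ s (Δ* U φ) ≗ Δ* U (Δ s φ)
  Δ-Δ* s []      φ-cong a = ≡.refl
  Δ-Δ* s (t ∷ U) φ-cong a =
    ≡.trans (Δ-comm s t (Δ*-cong U φ-cong) a) (Δ-resp-≗ t (Δ-Δ* s U φ-cong) a)

  τ-Δ : ∀ u t {φ} → Cong φ → τ u (Δ t φ) ≗ Δ t (τ u φ)
  τ-Δ u t {φ} φ-cong a = ≡.cong (_-_ (φ (u ∙ a))) (φ-cong (x∙yz≈y∙xz t u a))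

  τ-Δ* : ∀ u U {φ} → Cong φ → τ u (Δ* U φ) ≗ Δ* U (τ u φ)
  τ-Δ* u []      φ-cong a = ≡.refl
  τ-Δ* u (t ∷ U) φ-cong a =
    ≡.trans (τ-Δ u t (Δ*-cong U φ-cong) a) (Δ-resp-≗ t (τ-Δ* u U φ-cong) a)

  module _ {p : ℕ} where

    Δ-mod : ∀ t {φ ψ} → (∀ a → φ a ≡ ψ a mod p) → ∀ a → Δ t φ a ≡ Δ t ψ a mod p
    Δ-mod t φ≡ψ a = ≡-mod-- (φ≡ψ a) (φ≡ψ (t ∙ a))

    Δ*-mod : ∀ U {φ ψ} → (∀ a → φ a ≡ ψ a mod p) → ∀ a → Δ* U φ a ≡ Δ* U ψ a mod p
    Δ*-mod []      φ≡ψ = φ≡ψ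
    Δ*-mod (t ∷ U) φ≡ψ = Δ-mod t (Δ*-mod U φ≡ψ)

    Δ*-≡0-mod : ∀ U {φ} → (∀ a → φ a ≡ 0ℤ mod p) → ∀ a → Δ* U φ a ≡ 0ℤ mod p
    Δ*-≡0-mod U φ≡0 a = ≡-mod-trans (Δ*-mod U φ≡0 a) (≡-mod-reflexive (Δ*-0ᶠ U a))

  Δ*-replicate : ∀ k h {φ} → Cong φ → ∀ a → Δ* (replicate k h) φ a ≡ ∑altC (suc k) k (λ j → φ (j · h ∙ a))
  Δ*-replicate zero    h {φ} φ-cong a = ≡.trans (φ-cong (sym (identityˡ a))) (eq (φ (ε ∙ a)))
    where
    eq : ∀ x → x ≡ 1ℤ * x + 0ℤ
    eq = solve-∀
  Δ*-replicate (suc k) h {φ} φ-cong a = begin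
    Δ* (replicate k h) φ a - Δ* (replicate k h) φ (h ∙ a)
      ≡⟨ ≡.cong₂ _-_ (Δ*-replicate k h φ-cong a) (≡.trans (Δ*-replicate k h φ-cong (h ∙ a)) (∑altC-cong (suc k) k shift)) ⟩
    ∑altC (suc k) k f - ∑altC (suc k) k (λ j → f (suc j))
      ≡⟨ ≡.cong (_- ∑altC (suc k) k (λ j → f (suc j))) (≡.sym (∑altC-beyond k f)) ⟩
    ∑altC (suc (suc k)) k f - ∑altC (suc k) k (λ j → f (suc j))
      ≡⟨ ≡.sym (∑altC-suc (suc k) k f) ⟩
    ∑altC (suc (suc k)) (suc k) f
      ∎
    where
    open ≡.≡-Reasoning
    f : ℕ → ℤ
    f j = φ (j · h ∙ a)
    shift : ∀ j → φ (j · h ∙ (h ∙ a)) ≡ f (suc j)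
    shift j = φ-cong (trans (x∙yz≈y∙xz (j · h) h a) (sym (assoc h (j · h) a)))

  module _ {p : ℕ} (p-prime : Prime p) where

    Δ*-replicate-prime : ∀ h {φ} → Cong φ → ∀ a → Δ* (replicate p h) φ a ≡ Δ (p · h) φ a mod p
    Δ*-replicate-prime h {φ} φ-cong a = ≡-mod-trans
      (≡-mod-reflexive (Δ*-replicate p h φ-cong a))
      (≡-mod-trans (∑altC-prime p-prime (λ j → φ (j · h ∙ a)))
        (≡-mod-reflexive (≡.cong (_- φ (p · h ∙ a)) (φ-cong (identityˡ a)))))

    Δ*-replicate-* : ∀ k m x y → (∀ {ψ} → Cong ψ → ∀ a → Δ* (replicate m x) ψ a ≡ Δ y ψ a mod p) →
                     ∀ {ψ} → Cong ψ → ∀ a → Δ* (replicate (k ℕ.* m) x) ψ a ≡ Δ* (replicate k y) ψ a mod p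
    Δ*-replicate-* zero    m x y Δ*≡Δ ψ-cong a = ≡-mod-refl
    Δ*-replicate-* (suc k) m x y Δ*≡Δ {ψ} ψ-cong a = ≡-mod-trans
      (≡-mod-reflexive (≡.trans (≡.cong (λ U → Δ* U ψ a) (replicate-+ m (k ℕ.* m) x))
                                (≡.cong (λ χ → χ a) (Listₚ.foldr-++ Δ ψ (replicate m x) _))))
      (≡-mod-trans (Δ*≡Δ (Δ*-cong (replicate (k ℕ.* m) x) ψ-cong) a)
                   (Δ-mod y (Δ*-replicate-* k m x y Δ*≡Δ ψ-cong) a))

    Δ*-replicate-prime-power : ∀ l x {φ} → Cong φ → ∀ a →
                               Δ* (replicate (p ^ l) x) φ a ≡ Δ ((p ^ l) · x) φ a mod p
    Δ*-replicate-prime-power zero    x φ-cong a = ≡-mod-reflexive (Δ-resp-≈ φ-cong (sym (identityʳ x)) a)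
    Δ*-replicate-prime-power (suc l) x φ-cong a = ≡-mod-trans
      (Δ*-replicate-* p (p ^ l) x ((p ^ l) · x) (Δ*-replicate-prime-power l x) φ-cong a)
      (≡-mod-trans (Δ*-replicate-prime ((p ^ l) · x) φ-cong a)
                   (≡-mod-reflexive (Δ-resp-≈ φ-cong (×-assocˡ x p (p ^ l)) a)))

    Δ*-annihilated : ∀ l {e} → (p ^ l) · e ≈ ε → ∀ {φ} → Cong φ → ∀ a →
                     Δ* (replicate (p ^ l) e) φ a ≡ 0ℤ mod p
    Δ*-annihilated l pˡe≈ε φ-cong a = ≡-mod-trans
      (Δ*-replicate-prime-power l _ φ-cong a) (≡-mod-reflexive (Δ-ε φ-cong pˡe≈ε a))

module Olson {c ℓ : Level} (G : AbelianGroup c ℓ) {p : ℕ} (p-prime : Prime p) where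
  open import Data.Integer using (_+_)
  open AbelianGroup G
  open Multiples G
  open Differences G
  open Combinations G p

  Vanishes : List (Carrier × ℕ) → Set (c ⊔ ℓ)
  Vanishes B = ∀ T → All (InSpan B) T → D* B < length T →
               ∀ {φ} → Cong φ → ∀ a → Δ* T φ a ≡ 0ℤ mod p

  -- Deg≥ k is the k-th power of the augmentation ideal of ℤ[G], acting on functions
  -- G → ℤ, presented with respect to a splitting ⟨e⟩ + ⟨B⟩ of the generators.
  module Filtration (e : Carrier) (B : List (Carrier × ℕ)) where

    record Term (k : ℕ) : Set (c ⊔ ℓ) where
      constructor mkTerm
      field
        i      : ℕ
        U      : List Carrier
        ψ      : Fun
        ψ-cong : Cong ψ
        U∈B    : All (InSpan B) U
        degree : k ≤ i ℕ.+ length U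

      ⟦_⟧ : Fun
      ⟦_⟧ = Δ* (replicate i e) (Δ* U ψ)

      ⟦⟧-cong : Cong ⟦_⟧
      ⟦⟧-cong = Δ*-cong (replicate i e) (Δ*-cong U ψ-cong)

    open Term

    data Deg≥ (k : ℕ) : Fun → Set (c ⊔ ℓ) where
      term   : (t : Term k) → Deg≥ k ⟦ t ⟧
      _⊕ᵈ_   : ∀ {φ ψ} → Deg≥ k φ → Deg≥ k ψ → Deg≥ k (φ ⊕ ψ)
      resp-≗ : ∀ {φ ψ} → φ ≗ ψ → Deg≥ k φ → Deg≥ k ψ

    Deg≥-0ᶠ : ∀ k → Deg≥ k 0ᶠ
    Deg≥-0ᶠ k = resp-≗ (Δ*-0ᶠ (replicate k e)) (term (mkTerm k [] 0ᶠ (λ _ → ≡.refl) [] (ℕₚ.m≤m+n k 0)))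

    τ-Δₑ-Term : ∀ {k} (t : Term k) w → Deg≥ (suc k) (τ w (Δ e ⟦ t ⟧))
    τ-Δₑ-Term (mkTerm i U ψ ψ-cong U∈B k≤) w =
      resp-≗ (λ a → ≡.sym (≡.trans (τ-Δ* w (replicate (suc i) e) (Δ*-cong U ψ-cong) a)
                                   (Δ*-resp-≗ (replicate (suc i) e) (τ-Δ* w U ψ-cong) a)))
             (term (mkTerm (suc i) U (τ w ψ) (τ-cong w ψ-cong) U∈B (s≤s k≤)))

    τ-Δ·ₑ-Term : ∀ {k} (t : Term k) n u → Deg≥ (suc k) (τ u (Δ (n · e) ⟦ t ⟧))
    τ-Δ·ₑ-Term {k} t zero    u = resp-≗ (λ a → ≡.sym (Δ-ε (⟦⟧-cong t) refl (u ∙ a))) (Deg≥-0ᶠ (suc k))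
    τ-Δ·ₑ-Term {k} t (suc n) u = resp-≗ telescope (τ-Δ·ₑ-Term t n u ⊕ᵈ τ-Δₑ-Term t (n · e ∙ u))
      where
      telescope : τ u (Δ (n · e) ⟦ t ⟧) ⊕ τ (n · e ∙ u) (Δ e ⟦ t ⟧) ≗ τ u (Δ (suc n · e) ⟦ t ⟧)
      telescope x = ≡.sym (≡.trans (Δ-∙ e (n · e) (⟦⟧-cong t) (u ∙ x))
        (≡.cong (_+_ (Δ (n · e) ⟦ t ⟧ (u ∙ x))) (Δ-cong e (⟦⟧-cong t) (sym (assoc (n · e) u x)))))

    Deg≥-Δ : ∀ {k φ t l} → InSpan ((e , l) ∷ B) t → Deg≥ k φ → Deg≥ (suc k) (Δ t φ)
    Deg≥-Δ {t = t} t∈ (_⊕ᵈ_ {φ} {ψ} dφ dψ) = resp-≗ (λ a → ≡.sym (Δ-⊕ t φ ψ a)) (Deg≥-Δ t∈ dφ ⊕ᵈ Deg≥-Δ t∈ dψ)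
    Deg≥-Δ {t = t} t∈ (resp-≗ φ≗ψ dφ) = resp-≗ (Δ-resp-≗ t φ≗ψ) (Deg≥-Δ t∈ dφ)
    Deg≥-Δ {k} {t = t} t∈ (term s@(mkTerm i U ψ ψ-cong U∈B k≤)) with InSpan-∷⁻ t∈
    ... | n , y , y∈B , t≈ = resp-≗ split (term s′ ⊕ᵈ τ-Δ·ₑ-Term s n y)
      where
      s′ : Term (suc k)
      s′ = mkTerm i (y ∷ U) ψ ψ-cong (y∈B ∷ U∈B) (≡.subst (suc k ≤_) (≡.sym (ℕₚ.+-suc i (length U))) (s≤s k≤))
      split : ⟦ s′ ⟧ ⊕ τ y (Δ (n · e) ⟦ s ⟧) ≗ Δ t ⟦ s ⟧
      split x = ≡.sym (≡.trans (Δ-resp-≈ (⟦⟧-cong s) t≈ x) (≡.trans (Δ-∙ (n · e) y (⟦⟧-cong s) x)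
        (≡.cong (_+ τ y (Δ (n · e) ⟦ s ⟧) x) (Δ-Δ* y (replicate i e) (Δ*-cong U ψ-cong) x))))

  module _ {e l B} (pˡe≈ε : (p ^ l) · e ≈ ε) (B-vanishes : Vanishes B) where
    open Filtration e B
    open Term

    Term-vanishes : ∀ {k} (t : Term k) → (p ^ l ∸ 1) ℕ.+ D* B < k → ∀ a → ⟦ t ⟧ a ≡ 0ℤ mod p
    Term-vanishes (mkTerm i U ψ ψ-cong U∈B k≤) D*<k a with p ^ l ≤? i
    ... | yes pˡ≤i = ≡-mod-trans (≡-mod-reflexive regroup)
      (Δ*-≡0-mod (replicate (i ∸ p ^ l) e) (Δ*-annihilated p-prime l pˡe≈ε (Δ*-cong U ψ-cong)) a)
      where
      regroup : Δ* (replicate i e) (Δ* U ψ) a ≡ Δ* (replicate (i ∸ p ^ l) e) (Δ* (replicate (p ^ l) e) (Δ* U ψ)) a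
      regroup = ≡.trans (≡.cong (λ m → Δ* (replicate m e) (Δ* U ψ) a) (≡.sym (ℕₚ.m∸n+n≡m pˡ≤i)))
                (≡.trans (≡.cong (λ V → Δ* V (Δ* U ψ) a) (replicate-+ (i ∸ p ^ l) (p ^ l) e))
                         (≡.cong (λ χ → χ a) (Listₚ.foldr-++ Δ (Δ* U ψ) (replicate (i ∸ p ^ l) e) _)))
    ... | no pˡ≰i = Δ*-≡0-mod (replicate i e) (B-vanishes U U∈B D*<|U| ψ-cong) a
      where
      i≤pˡ-1 : i ≤ p ^ l ∸ 1
      i≤pˡ-1 = ℕₚ.suc[m]≤n⇒m≤pred[n] (ℕₚ.≰⇒> pˡ≰i)
      D*<|U| : D* B < length U
      D*<|U| = ℕₚ.+-cancelˡ-< (p ^ l ∸ 1) (D* B) (length U)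
        (ℕₚ.<-≤-trans D*<k (ℕₚ.≤-trans k≤ (ℕₚ.+-monoˡ-≤ (length U) i≤pˡ-1)))

    Deg≥-vanishes : ∀ {k φ} → Deg≥ k φ → (p ^ l ∸ 1) ℕ.+ D* B < k → ∀ a → φ a ≡ 0ℤ mod p
    Deg≥-vanishes (term t)        D*<k a = Term-vanishes t D*<k a
    Deg≥-vanishes (dφ ⊕ᵈ dψ)      D*<k a = ≡-mod-+ (Deg≥-vanishes dφ D*<k a) (Deg≥-vanishes dψ D*<k a)
    Deg≥-vanishes (resp-≗ φ≗ψ dφ) D*<k a = ≡-mod-trans (≡-mod-reflexive (≡.sym (φ≗ψ a))) (Deg≥-vanishes dφ D*<k a)

  Δ*-vanishes : ∀ B → Annihilates B → Vanishes B
  Δ*-vanishes [] _ (t ∷ T) ((_ , t≈ε) ∷ _) _ φ-cong a =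
    ≡-mod-reflexive (Δ-ε (Δ*-cong T φ-cong) t≈ε a)
  Δ*-vanishes ((e , l) ∷ B) (pˡe≈ε ∷ ann) T T∈ D*<|T| {φ} φ-cong =
    Deg≥-vanishes {l = l} pˡe≈ε (Δ*-vanishes B ann) (Deg≥-Δ* T T∈) D*<|T|
    where
    open Filtration e B
    Deg≥-Δ* : ∀ T → All (InSpan ((e , l) ∷ B)) T → Deg≥ (length T) (Δ* T φ)
    Deg≥-Δ* []      []         = term (mkTerm 0 [] φ φ-cong [] z≤n)
    Deg≥-Δ* (t ∷ T) (t∈ ∷ T∈) = Deg≥-Δ t∈ (Deg≥-Δ* T T∈)

-- Zero-sumfree sequences

module StandardSequence {c ℓ : Level} (G : AbelianGroup c ℓ) (p : ℕ) .{{_ : NonZero p}} where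
  open AbelianGroup G
  open Multiples G
  open Combinations G p

  standardSequence : List (Carrier × ℕ) → List Carrier
  standardSequence []            = []
  standardSequence ((e , l) ∷ B) = replicate (p ^ l ∸ 1) e ++ standardSequence B

  length-standardSequence : ∀ B → length (standardSequence B) ≡ D* B
  length-standardSequence []            = ≡.refl
  length-standardSequence ((e , l) ∷ B) = ≡.trans (Listₚ.length-++ (replicate (p ^ l ∸ 1) e))
    (≡.cong₂ ℕ._+_ (Listₚ.length-replicate (p ^ l ∸ 1)) (length-standardSequence B))

  ⊆-standardSequence⁻ : ∀ B {U} → U ⊆ standardSequence B →
    Σ (List ℕ) λ bs → Bounded B bs × σ G U ≈ lincomb B bs × (All (_≡ 0) bs → U ≡ [])
  ⊆-standardSequence⁻ []            []  = [] , [] , refl , λ _ → ≡.refl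
  ⊆-standardSequence⁻ ((e , l) ∷ B) U⊆ with ⊆-++⁻ (replicate (p ^ l ∸ 1) e) (standardSequence B) U⊆
  ... | U₁ , U₂ , ≡.refl , U₁⊆ , U₂⊆ with ⊆-replicate⁻ (p ^ l ∸ 1) e U₁⊆ | ⊆-standardSequence⁻ B U₂⊆
  ...   | m , m≤ , ≡.refl | bs , bounded , σU₂≈ , bs≡0⇒U₂≡[] =
    m ∷ bs , m<pˡ ∷ bounded , trans (σ-++ (replicate m e) U₂) (∙-cong (reflexive (σ-replicate m e)) σU₂≈) , empty
    where
    m<pˡ : m < p ^ l
    m<pˡ = ℕₚ.m≤pred[n]⇒suc[m]≤n {{ℕₚ.m^n≢0 p l}} m≤
    empty : All (_≡ 0) (m ∷ bs) → replicate m e ++ U₂ ≡ []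
    empty (≡.refl ∷ bs≡0) = bs≡0⇒U₂≡[] bs≡0

  standardSequence-zeroSumFree : ∀ B → Independent B → ZeroSumFree G (standardSequence B)
  standardSequence-zeroSumFree B independent U U⊆ U≢[] σU≈ε with ⊆-standardSequence⁻ B U⊆
  ... | bs , bounded , σU≈ , bs≡0⇒U≡[] = U≢[] (bs≡0⇒U≡[] (independent bs bounded (trans (sym σU≈) σU≈ε)))

  D*≤Davenport : ∀ {B D} → Independent B → IsDavenport G D → D* B ≤ D
  D*≤Davenport {B} independent (_ , maximal) = ≡.subst (_≤ _) (length-standardSequence B)
    (maximal (standardSequence B) (standardSequence-zeroSumFree B independent))

module Indicator {c ℓ : Level} (G : AbelianGroup c ℓ) (_≟_ : Decidable (AbelianGroup._≈_ G)) where
  open import Data.Integer using (_-_)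
  open AbelianGroup G hiding (_-_)
  open Multiples G using (x∙yz≈y∙xz)
  open Differences G

  δ : Fun
  δ a with a ≟ ε
  ... | yes _ = 1ℤ
  ... | no  _ = 0ℤ

  δ-cong : Cong δ
  δ-cong {x} {y} x≈y with x ≟ ε | y ≟ ε
  ... | yes _   | yes _   = ≡.refl
  ... | no  _   | no  _   = ≡.refl
  ... | yes x≈ε | no  y≉ε = ⊥-elim (y≉ε (trans (sym x≈y) x≈ε))
  ... | no  x≉ε | yes y≈ε = ⊥-elim (x≉ε (trans x≈y y≈ε))

  -- Δ* S δ a = Σ_{U ⊆ S} (-1)^|U| δ (σ U ∙ a), so it vanishes if no σ U ∙ a is ε.
  Δ*-δ-avoiding : ∀ S a → (∀ U → U ⊆ S → ¬ (σ G U ∙ a ≈ ε)) → Δ* S δ a ≡ 0ℤ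
  Δ*-δ-avoiding [] a avoids with a ≟ ε
  ... | yes a≈ε = ⊥-elim (avoids [] [] (trans (identityˡ a) a≈ε))
  ... | no  _   = ≡.refl
  Δ*-δ-avoiding (t ∷ S) a avoids = ≡.cong₂ _-_
    (Δ*-δ-avoiding S a (λ U U⊆ → avoids U (t ∷ʳ U⊆)))
    (Δ*-δ-avoiding S (t ∙ a) (λ U U⊆ σU∙ta≈ε →
      avoids (t ∷ U) (≡.refl ∷ U⊆) (trans (trans (assoc t (σ G U) a) (x∙yz≈y∙xz t (σ G U) a)) σU∙ta≈ε)))

  Δ*-δ-zeroSumFree : ∀ S → ZeroSumFree G S → Δ* S δ ε ≡ 1ℤ
  Δ*-δ-zeroSumFree [] _ with ε ≟ ε
  ... | yes _   = ≡.refl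
  ... | no  ε≉ε = ⊥-elim (ε≉ε refl)
  Δ*-δ-zeroSumFree (t ∷ S) zsf = ≡.cong₂ _-_
    (Δ*-δ-zeroSumFree S (λ U U⊆ → zsf U (t ∷ʳ U⊆)))
    (Δ*-δ-avoiding S (t ∙ ε) (λ U U⊆ σU∙tε≈ε → zsf (t ∷ U) (≡.refl ∷ U⊆) (λ ())
      (trans (∙-congˡ (sym (identityʳ (σ G U)))) (trans (x∙yz≈y∙xz t (σ G U) ε) σU∙tε≈ε))))

module _ {c ℓ : Level} (G : AbelianGroup c ℓ) {p : ℕ} (p-prime : Prime p)
         (_≟_ : Decidable (AbelianGroup._≈_ G)) where
  open AbelianGroup G
  open Multiples G
  open Differences G
  open Combinations G p
  open Indicator G _≟_
  open Olson G p-prime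
  open StandardSequence G p {{prime⇒nonZero p-prime}}

  no-p-multiple-in-long-zeroSumFree : Basis → ∀ {D} → IsDavenport G D →
    ∀ {S} → ZeroSumFree G S → D ℕ.+ 2 ≤ length S ℕ.+ p → ∀ {g} → g ∈ S → ∀ h → ¬ (g ≈ p · h)
  no-p-multiple-in-long-zeroSumFree basis {D} isD {S} zsf long {g} g∈S h g≈ph with ∈-∃++ g∈S
  ... | A , R , ≡.refl = 1≢0-mod {{prime⇒nonTrivial p-prime}} (≡-mod-trans (≡-mod-sym T≡1) T≡0)
    where
    open Basis basis
    T = A ++ replicate p h ++ R
    |T| : length T ≡ length A ℕ.+ (p ℕ.+ length R)
    |T| = ≡.trans (Listₚ.length-++ A) (≡.cong (length A ℕ.+_)
            (≡.trans (Listₚ.length-++ (replicate p h)) (≡.cong (ℕ._+ length R) (Listₚ.length-replicate p))))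
    |S|+p≡1+|T| : length S ℕ.+ p ≡ suc (length T)
    |S|+p≡1+|T| = ≡.trans (≡.cong (ℕ._+ p) (Listₚ.length-++ A))
                   (≡.trans (arith (length A) (length R) p) (≡.cong suc (≡.sym |T|)))
      where
      arith : ∀ a b c → a ℕ.+ suc b ℕ.+ c ≡ suc (a ℕ.+ (c ℕ.+ b))
      arith = ℕ-Solver.solve-∀
    D<|T| : D < length T
    D<|T| = ℕₚ.≤-pred (≡.subst₂ _≤_ (ℕₚ.+-comm D 2) |S|+p≡1+|T| long)
    T≡0 : Δ* T δ ε ≡ 0ℤ mod p
    T≡0 = Δ*-vanishes elements annihilates T (All.tabulate λ {x} _ → spans x)
            (ℕₚ.≤-<-trans (D*≤Davenport independent isD) D<|T|) δ-cong ε
    T≡1 : Δ* T δ ε ≡ 1ℤ mod p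
    T≡1 = begin
      Δ* T δ ε                                         ≡⟨ ≡.cong (λ χ → χ ε) (Listₚ.foldr-++ Δ δ A (replicate p h ++ R)) ⟩
      Δ* A (Δ* (replicate p h ++ R) δ) ε               ≡⟨ ≡.cong (λ χ → Δ* A χ ε) (Listₚ.foldr-++ Δ δ (replicate p h) R) ⟩
      Δ* A (Δ* (replicate p h) (Δ* R δ)) ε             ≈⟨ Δ*-mod A (Δ*-replicate-prime p-prime h (Δ*-cong R δ-cong)) ε ⟩
      Δ* A (Δ (p · h) (Δ* R δ)) ε                      ≡⟨ Δ*-resp-≗ A (Δ-resp-≈ (Δ*-cong R δ-cong) (sym g≈ph)) ε ⟩
      Δ* A (Δ* (g ∷ R) δ) ε                            ≡⟨ ≡.cong (λ χ → χ ε) (Listₚ.foldr-++ Δ δ A (g ∷ R)) ⟨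
      Δ* S δ ε                                         ≡⟨ Δ*-δ-zeroSumFree S zsf ⟩
      1ℤ                                               ∎
      where open import Relation.Binary.Reasoning.Setoid (≡-mod-setoid p)

module Finite {c ℓ : Level} (G : AbelianGroup c ℓ) (xs : List (AbelianGroup.Carrier G))
              (covers : ∀ x → Any (AbelianGroup._≈_ G x) xs) where
  open AbelianGroup G
  open Multiples G

  ¬¬-decidable : ¬ ¬ Decidable _≈_
  ¬¬-decidable ¬dec = ¬¬-All xs (λ y → ¬¬-All xs λ z → ¬¬-excluded-middle {A = y ≈ z}) λ table → ¬dec λ x y →
    let x′ , x′∈ , x≈x′ = find (covers x)
        y′ , y′∈ , y≈y′ = find (covers y)
    in  map′ (λ x′≈y′ → trans x≈x′ (trans x′≈y′ (sym y≈y′)))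
             (λ x≈y → trans (sym x≈x′) (trans x≈y y≈y′))
             (All.lookup (All.lookup table x′∈) y′∈)

  module _ {p : ℕ} (p-prime : Prime p) where
    open BasisTheorem {c} {ℓ} p-prime

    exponent : IsPTorsion G p → ∃ (HasExponent G)
    exponent p-torsion with bound xs
      where
      bound : ∀ ys → ∃ λ K → All (λ y → (p ^ K) · y ≈ ε) ys
      bound []       = 0 , []
      bound (y ∷ ys) with p-torsion y | bound ys
      ... | m , pᵐy≈ε | K , pᴷys≈ε = m ℕ.⊔ K ,
        ·-annihilates-mono p (ℕₚ.m≤m⊔n m K) (trans (reflexive (≡.sym (mulℕ≡· (p ^ m) y))) pᵐy≈ε) ∷
        All.map (·-annihilates-mono p (ℕₚ.m≤n⊔m m K)) pᴷys≈ε
    ... | K , pᴷxs≈ε = K , λ x → let y , y∈ , x≈y = find (covers x) in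
                               trans (×-congʳ (p ^ K) x≈y) (All.lookup pᴷxs≈ε y∈)

    generated : ∀ x → Generated G xs x
    generated x = let y , y∈ , x≈y = find (covers x) in
                  generated-∙ y∈ (generated-ε refl) (trans x≈y (sym (identityʳ y)))

open import Data.Nat using (_+_)

lemma5p1 : {c ℓ : Level} (p : ℕ) → Prime p → (G : AbelianGroup c ℓ) → IsFinitePGroup G p →
    (D : ℕ) → IsDavenport G D →
    (S : List (AbelianGroup.Carrier G)) → ZeroSumFree G S → D + 2 ≤ length S + p →
    ∀ g → g ∈ S → HasHeight G p g 1
lemma5p1 p p-prime G ((xs , covers) , p-torsion) D isDavenport S zeroSumFree long g g∈S =
  (0 , ≡.refl , g , sym (identityʳ g)) , height≤1
  where
  open AbelianGroup G
  open Multiples G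
  open Finite G xs covers
  open BasisTheorem p-prime

  K,pᴷ≈ε = exponent p-prime p-torsion

  height≤1 : ∀ n → (∃ λ h → g ≈ mulℕ G (p ^ n) h) → p ^ n ≤ 1
  height≤1 zero    _         = ℕₚ.≤-refl
  height≤1 (suc n) (h , g≈) = ⊥-elim (¬¬-decidable λ _≟_ →
    no-p-multiple-in-long-zeroSumFree G p-prime _≟_
      (hasBasis (length xs) G _≟_ {proj₁ K,pᴷ≈ε} (proj₂ K,pᴷ≈ε) xs ℕₚ.≤-refl (generated p-prime))
      isDavenport zeroSumFree long g∈S ((p ^ n) · h)
      (trans g≈ (trans (reflexive (mulℕ≡· (p ^ suc n) h)) (sym (×-assocˡ h p (p ^ n))))))
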